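{- Let $t>2$ be an integer, let $k\geq 3$ be an odd integer, and let $G=D(t-1,t)$. Then $\mathrm{rl}_k(G)\leq \frac t2 k^2+k-\frac{t+2}{2}$.
   Context: For a finite set $D=\{d_1<\dots<d_m\}$ of positive integers, the distance graph $D(d_1,\dots,d_m)$ has vertex set $\mathbb{Z}$, two distinct integers $i,j$ being adjacent iff $|i-j|\in D$. For a connected graph $G$ with graph distance $d(\cdot,\cdot)$ and an integer $k\ge 1$, a radio $k$-labeling of $G$ is a map $c:V(G)\to\mathbb{Z}_{\ge 0}$ such that $|c(u)-c(v)|\geq k+1-d(u,v)$ for all distinct vertices $u,v$. Its span is $\max\{c(x)-c(y): x,y\in V(G)\}$ (a supremum for infinite graphs), and the radio $k$-labeling number $\mathrm{rl}_k(G)$ is the minimum span over all radio $k$-labelings of $G$. -}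

module Defs where

open import Data.Nat using (ℕ; zero; suc; _+_; _*_; _∸_; _≤_; ∣_-_∣)
open import Data.Integer as ℤ using (ℤ)
open import Data.List using (List; _∷_; [])
open import Data.List.Membership.Propositional using (_∈_)
open import Data.Product using (Σ; _×_)
open import Relation.Binary.PropositionalEquality using (_≡_; _≢_)

-- Distance graph D(d₁,…,dₘ) on ℤ: i ~ j iff |i - j| ∈ D.
-- (i ≠ j is automatic since all elements of D are positive in our use.)
DistAdj : List ℕ → ℤ → ℤ → Set
DistAdj D i j = ℤ.∣ i ℤ.- j ∣ ∈ D

data Walk {V : Set} (Adj : V → V → Set) : ℕ → V → V → Set where
  nil  : ∀ {u} → Walk Adj zero u u
  cons : ∀ {n u v w} → Adj u v → Walk Adj n v w → Walk Adj (suc n) u w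

IsDist : {V : Set} → (V → V → Set) → V → V → ℕ → Set
IsDist Adj u v n = Walk Adj n u v × (∀ m → Walk Adj m u v → n ≤ m)

IsRadioLabeling : {V : Set} → (V → V → Set) → ℕ → (V → ℕ) → Set
IsRadioLabeling Adj k c =
  ∀ u v → u ≢ v → ∀ n → IsDist Adj u v n → k + 1 ≤ ∣ c u - c v ∣ + n

-- Span of c is at most B: c(x) - c(y) ≤ B for all x, y (span is a supremum).
SpanAtMost : {V : Set} → (V → ℕ) → ℕ → Set
SpanAtMost c B = ∀ x y → c x ∸ c y ≤ B

-- rl_k(G) ≤ B  iff some radio k-labeling has span ≤ B.
RlAtMost : {V : Set} → (V → V → Set) → ℕ → ℕ → Set
RlAtMost Adj k B = Σ (_ → ℕ) (λ c → IsRadioLabeling Adj k c × SpanAtMost c B)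

G : ℕ → ℤ → ℤ → Set
G t = DistAdj ((t ∸ 1) ∷ t ∷ [])

-- Write k = 2h + 1 and N = (k + 1) t + 3, which is odd, and label x by h · (2x mod N).
-- Vertices at graph distance n are at most n t apart on ℤ, and vertices at distance 1
-- are at least t - 1 ≥ 2 apart. As long as 2|u - v| plus the gap between the residues
-- stays below N, those residues can only differ by 2|u - v| itself, and doubling is
-- injective modulo the odd N. Hence the residues of u ≠ v differ by at least 1, 2, 3
-- when n ≤ 2h + 1, n ≤ h + 1, n = 1 respectively, which is exactly what k + 1 ≤ h·gap + n
-- needs; the labels lie in [0, h (N - 1)] and h (N - 1) is the bound of the theorem.
module Submission where

open import Defs
open import Data.Nat using (ℕ; _+_; _*_; _∸_; _<_; _≤_)
open import Data.Nat.Divisibility using (_∣_)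
open import Relation.Nullary using (¬_)
open import Relation.Binary.PropositionalEquality using (_≡_)

open import Data.Nat using (zero; suc; z≤n; s≤s; ∣_-_∣; _≤?_; _<?_; >-nonZero)
open import Data.Nat.Properties
open import Data.Nat.Divisibility using (divides; ∣⇒≤)
open import Data.Nat.Coprimality using (Coprime; 1-coprimeTo; coprime-+; coprime-divisor)
open import Data.Nat.Tactic.RingSolver using (solve-∀)
open import Data.Integer as ℤ using (ℤ; +_)
import Data.Integer.Properties as ℤ
open import Data.Integer.DivMod using (_%ℕ_; _/ℕ_; n%ℕd<d; a≡a%ℕn+[a/ℕn]*n)
import Data.Integer.Tactic.RingSolver as ℤ-Solver
open import Data.List.Relation.Unary.All as All using (All; _∷_; [])
open import Data.Product using (∃-syntax; _,_)
open import Function using (_∘_)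
open import Data.Sum using (inj₁; inj₂)
open import Relation.Nullary using (yes; no; contradiction)
open import Relation.Binary.PropositionalEquality using (_≢_; refl; sym; trans; cong; cong₂; subst; module ≡-Reasoning)

odd⇒≡suc-double : ∀ k → ¬ (2 ∣ k) → ∃[ h ] k ≡ suc (2 * h)
odd⇒≡suc-double zero 2∤k = contradiction (divides 0 refl) 2∤k
odd⇒≡suc-double (suc zero) 2∤k = 0 , refl
odd⇒≡suc-double (suc (suc k)) 2∤k+2
  with odd⇒≡suc-double k (λ { (divides q k≡q*2) → 2∤k+2 (divides (suc q) (cong (λ x → suc (suc x)) k≡q*2)) })
... | h , refl = suc h , cong suc (sym (*-suc 2 h))

coprime-odd-2 : ∀ m → Coprime (suc (2 * m)) 2
coprime-odd-2 zero = 1-coprimeTo 2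
coprime-odd-2 (suc m) = subst (λ x → Coprime (suc x) 2) (sym (*-suc 2 m)) (coprime-+ (coprime-odd-2 m))

∣+m-+n∣≡∣m-n∣ : ∀ m n → ℤ.∣ + m ℤ.- + n ∣ ≡ ∣ m - n ∣
∣+m-+n∣≡∣m-n∣ m n rewrite ℤ.m-n≡m⊖n m n with ≤-total m n
... | inj₁ m≤n = trans (ℤ.∣⊖∣-≤ m≤n) (sym (m≤n⇒∣m-n∣≡n∸m m≤n))
... | inj₂ n≤m = begin
  ℤ.∣ m ℤ.⊖ n ∣ ≡⟨ ℤ.∣m⊖n∣≡∣n⊖m∣ m n ⟩
  ℤ.∣ n ℤ.⊖ m ∣ ≡⟨ ℤ.∣⊖∣-≤ n≤m ⟩
  m ∸ n         ≡⟨ sym (m≤n⇒∣m-n∣≡n∸m n≤m) ⟩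
  ∣ n - m ∣     ≡⟨ ∣-∣-comm n m ⟩
  ∣ m - n ∣     ∎
  where open ≡-Reasoning

i≡j+k*n⇒i≡j : ∀ {i j k} n → i ≡ j ℤ.+ k ℤ.* + n → ℤ.∣ i ∣ + ℤ.∣ j ∣ < n → i ≡ j
i≡j+k*n⇒i≡j {i} {j} {k} n i≡j+k*n small =
  trans i≡j+k*n (trans (cong (λ x → j ℤ.+ x ℤ.* + n) (ℤ.∣i∣≡0⇒i≡0 {k} ∣k∣≡0)) (ℤ.+-identityʳ j))
  where
  k*n≡i-j : k ℤ.* + n ≡ i ℤ.- j
  k*n≡i-j = trans (sym (cancel j (k ℤ.* + n))) (cong (ℤ._- j) (sym i≡j+k*n))
    where
    cancel : ∀ a b → (a ℤ.+ b) ℤ.- a ≡ b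
    cancel = ℤ-Solver.solve-∀
  ∣k∣*n<n : ℤ.∣ k ∣ * n < n
  ∣k∣*n<n = begin-strict
    ℤ.∣ k ∣ * n           ≡⟨ sym (ℤ.∣i*j∣≡∣i∣*∣j∣ k (+ n)) ⟩
    ℤ.∣ k ℤ.* + n ∣       ≡⟨ cong ℤ.∣_∣ k*n≡i-j ⟩
    ℤ.∣ i ℤ.- j ∣         ≤⟨ ℤ.∣i-j∣≤∣i∣+∣j∣ i j ⟩
    ℤ.∣ i ∣ + ℤ.∣ j ∣     <⟨ small ⟩
    n                     ∎
    where open ≤-Reasoning
  ∣k∣≡0 : ℤ.∣ k ∣ ≡ 0
  ∣k∣≡0 = n<1⇒n≡0 (*-cancelʳ-< n (ℤ.∣ k ∣) 1 (subst (ℤ.∣ k ∣ * n <_) (sym (*-identityˡ n)) ∣k∣*n<n))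

walk-displacement-≤ : ∀ {D t n u v} → All (_≤ t) D → Walk (DistAdj D) n u v → ℤ.∣ u ℤ.- v ∣ ≤ n * t
walk-displacement-≤ {u = u} _ nil = subst (λ x → ℤ.∣ x ∣ ≤ 0) (sym (ℤ.+-inverseʳ u)) z≤n
walk-displacement-≤ {t = t} {suc n} {u} {v} D≤t (cons {v = w} u~w w⇝v) = begin
  ℤ.∣ u ℤ.- v ∣                 ≡⟨ cong ℤ.∣_∣ (sym (ℤ.+-minus-telescope u w v)) ⟩
  ℤ.∣ (u ℤ.- w) ℤ.+ (w ℤ.- v) ∣ ≤⟨ ℤ.∣i+j∣≤∣i∣+∣j∣ (u ℤ.- w) (w ℤ.- v) ⟩
  ℤ.∣ u ℤ.- w ∣ + ℤ.∣ w ℤ.- v ∣ ≤⟨ +-mono-≤ (All.lookup D≤t u~w) (walk-displacement-≤ D≤t w⇝v) ⟩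
  t + n * t                     ∎
  where open ≤-Reasoning

walk-length-pos : ∀ {V : Set} {Adj : V → V → Set} {n u v} → u ≢ v → Walk Adj n u v → 1 ≤ n
walk-length-pos u≢v nil = contradiction refl u≢v
walk-length-pos _ (cons _ _) = s≤s z≤n

walk-≤1⇒adjacent : ∀ {V : Set} {Adj : V → V → Set} {n u v} → u ≢ v → n ≤ 1 → Walk Adj n u v → Adj u v
walk-≤1⇒adjacent u≢v _ nil = contradiction refl u≢v
walk-≤1⇒adjacent _ _ (cons u~v nil) = u~v
walk-≤1⇒adjacent _ (s≤s ()) (cons _ (cons _ _))

module DoublingResidue (m : ℕ) where

  N : ℕ
  N = suc (2 * m)

  residue : ℤ → ℕ
  residue x = (+ 2 ℤ.* x) %ℕ N

  residue-≤ : ∀ x → residue x ≤ 2 * m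
  residue-≤ x = ≤-pred (n%ℕd<d (+ 2 ℤ.* x) N)

  double-difference : ∀ u v → ∃[ q ] + 2 ℤ.* (u ℤ.- v) ≡ (+ residue u ℤ.- + residue v) ℤ.+ q ℤ.* + N
  double-difference u v = quotient u ℤ.- quotient v , (begin
    + 2 ℤ.* (u ℤ.- v)          ≡⟨ distrib (+ 2) u v ⟩
    + 2 ℤ.* u ℤ.- + 2 ℤ.* v    ≡⟨ cong₂ ℤ._-_ (a≡a%ℕn+[a/ℕn]*n (+ 2 ℤ.* u) N) (a≡a%ℕn+[a/ℕn]*n (+ 2 ℤ.* v) N) ⟩
    (+ residue u ℤ.+ quotient u ℤ.* + N) ℤ.- (+ residue v ℤ.+ quotient v ℤ.* + N)
                               ≡⟨ regroup (+ residue u) (+ residue v) (quotient u) (quotient v) (+ N) ⟩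
    (+ residue u ℤ.- + residue v) ℤ.+ (quotient u ℤ.- quotient v) ℤ.* + N ∎)
    where
    open ≡-Reasoning
    quotient : ℤ → ℤ
    quotient x = (+ 2 ℤ.* x) /ℕ N
    distrib : ∀ a x y → a ℤ.* (x ℤ.- y) ≡ a ℤ.* x ℤ.- a ℤ.* y
    distrib = ℤ-Solver.solve-∀
    regroup : ∀ a b c d n → (a ℤ.+ c ℤ.* n) ℤ.- (b ℤ.+ d ℤ.* n) ≡ (a ℤ.- b) ℤ.+ (c ℤ.- d) ℤ.* n
    regroup = ℤ-Solver.solve-∀

  residue-injective : ∀ u v → 0 < ℤ.∣ u ℤ.- v ∣ → ℤ.∣ u ℤ.- v ∣ < N → residue u ≢ residue v
  residue-injective u v 0<∣u-v∣ ∣u-v∣<N ru≡rv with double-difference u v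
  ... | q , 2[u-v]≡ = <⇒≱ ∣u-v∣<N (∣⇒≤ {{>-nonZero 0<∣u-v∣}} N∣∣u-v∣)
    where
    2∣u-v∣≡∣q∣*N : 2 * ℤ.∣ u ℤ.- v ∣ ≡ ℤ.∣ q ∣ * N
    2∣u-v∣≡∣q∣*N = begin
      2 * ℤ.∣ u ℤ.- v ∣                                       ≡⟨ sym (ℤ.∣i*j∣≡∣i∣*∣j∣ (+ 2) (u ℤ.- v)) ⟩
      ℤ.∣ + 2 ℤ.* (u ℤ.- v) ∣                                 ≡⟨ cong ℤ.∣_∣ 2[u-v]≡ ⟩
      ℤ.∣ (+ residue u ℤ.- + residue v) ℤ.+ q ℤ.* + N ∣       ≡⟨ cong (λ r → ℤ.∣ (+ residue u ℤ.- + r) ℤ.+ q ℤ.* + N ∣) (sym ru≡rv) ⟩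
      ℤ.∣ (+ residue u ℤ.- + residue u) ℤ.+ q ℤ.* + N ∣       ≡⟨ cong (λ z → ℤ.∣ z ℤ.+ q ℤ.* + N ∣) (ℤ.+-inverseʳ (+ residue u)) ⟩
      ℤ.∣ + 0 ℤ.+ q ℤ.* + N ∣                                 ≡⟨ cong ℤ.∣_∣ (ℤ.+-identityˡ (q ℤ.* + N)) ⟩
      ℤ.∣ q ℤ.* + N ∣                                         ≡⟨ ℤ.∣i*j∣≡∣i∣*∣j∣ q (+ N) ⟩
      ℤ.∣ q ∣ * N                                             ∎
      where open ≡-Reasoning
    N∣∣u-v∣ : N ∣ ℤ.∣ u ℤ.- v ∣
    N∣∣u-v∣ = coprime-divisor (coprime-odd-2 m) (divides ℤ.∣ q ∣ 2∣u-v∣≡∣q∣*N)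

  residue-gap-> : ∀ u v {e} → e < 2 * ℤ.∣ u ℤ.- v ∣ → 2 * ℤ.∣ u ℤ.- v ∣ + e < N →
                  e < ∣ residue u - residue v ∣
  residue-gap-> u v {e} e<2∣u-v∣ 2∣u-v∣+e<N with double-difference u v | e <? ∣ residue u - residue v ∣
  ... | _ | yes e<gap = e<gap
  ... | q , 2[u-v]≡ | no e≮gap = contradiction e<2∣u-v∣ (≤⇒≯ (begin
    2 * ℤ.∣ u ℤ.- v ∣                   ≡⟨ sym (ℤ.∣i*j∣≡∣i∣*∣j∣ (+ 2) (u ℤ.- v)) ⟩
    ℤ.∣ + 2 ℤ.* (u ℤ.- v) ∣             ≡⟨ cong ℤ.∣_∣ (i≡j+k*n⇒i≡j {j = + residue u ℤ.- + residue v} {k = q} N 2[u-v]≡ small) ⟩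
    ℤ.∣ + residue u ℤ.- + residue v ∣   ≡⟨ ∣+m-+n∣≡∣m-n∣ (residue u) (residue v) ⟩
    ∣ residue u - residue v ∣           ≤⟨ gap≤e ⟩
    e                                   ∎))
    where
    open ≤-Reasoning
    gap≤e : ∣ residue u - residue v ∣ ≤ e
    gap≤e = ≮⇒≥ e≮gap
    small : ℤ.∣ + 2 ℤ.* (u ℤ.- v) ∣ + ℤ.∣ + residue u ℤ.- + residue v ∣ < N
    small = begin-strict
      ℤ.∣ + 2 ℤ.* (u ℤ.- v) ∣ + ℤ.∣ + residue u ℤ.- + residue v ∣
        ≡⟨ cong₂ _+_ (ℤ.∣i*j∣≡∣i∣*∣j∣ (+ 2) (u ℤ.- v)) (∣+m-+n∣≡∣m-n∣ (residue u) (residue v)) ⟩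
      2 * ℤ.∣ u ℤ.- v ∣ + ∣ residue u - residue v ∣ ≤⟨ +-monoʳ-≤ (2 * ℤ.∣ u ℤ.- v ∣) gap≤e ⟩
      2 * ℤ.∣ u ℤ.- v ∣ + e                         <⟨ 2∣u-v∣+e<N ⟩
      N                                             ∎

2h+2≤h*g+n : ∀ {h n g} → 1 ≤ h → 1 ≤ n →
             (n ≤ 2 * h + 1 → 1 ≤ g) → (n ≤ h + 1 → 2 ≤ g) → (n ≤ 1 → 3 ≤ g) →
             suc (2 * h) + 1 ≤ h * g + n
2h+2≤h*g+n {h} {n} {g} 1≤h 1≤n g≥1 g≥2 g≥3 with n ≤? 1 | n ≤? h + 1 | n ≤? 2 * h + 1
... | yes n≤1 | _ | _ = begin
  suc (2 * h) + 1   ≡⟨ eq₁ h ⟩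
  h * 2 + (1 + 1)   ≤⟨ +-monoʳ-≤ (h * 2) (+-monoˡ-≤ 1 1≤h) ⟩
  h * 2 + (h + 1)   ≡⟨ eq₂ h ⟩
  h * 3 + 1         ≤⟨ +-mono-≤ (*-monoʳ-≤ h (g≥3 n≤1)) 1≤n ⟩
  h * g + n         ∎
  where
  open ≤-Reasoning
  eq₁ : ∀ h → suc (2 * h) + 1 ≡ h * 2 + (1 + 1)
  eq₁ = solve-∀
  eq₂ : ∀ h → h * 2 + (h + 1) ≡ h * 3 + 1
  eq₂ = solve-∀
... | no n≰1 | yes n≤h+1 | _ = ≤-trans (≤-reflexive (eq h)) (+-mono-≤ (*-monoʳ-≤ h (g≥2 n≤h+1)) (≰⇒> n≰1))
  where
  eq : ∀ h → suc (2 * h) + 1 ≡ h * 2 + 2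
  eq = solve-∀
... | no _ | no n≰h+1 | yes n≤2h+1 = ≤-trans (≤-reflexive (eq h)) (+-mono-≤ (*-monoʳ-≤ h (g≥1 n≤2h+1)) (≰⇒> n≰h+1))
  where
  eq : ∀ h → suc (2 * h) + 1 ≡ h * 1 + suc (h + 1)
  eq = solve-∀
... | no _ | no _ | no n≰2h+1 = ≤-trans (≰⇒> n≰2h+1) (m≤n+m n (h * g))

bounded⇒SpanAtMost : ∀ {V : Set} {c : V → ℕ} {B} → (∀ x → c x ≤ B) → SpanAtMost c B
bounded⇒SpanAtMost {c = c} c≤B x y = ≤-trans (m∸n≤m (c x) (c y)) (c≤B x)

module Construction (t h : ℕ) (2<t : 2 < t) (1≤h : 1 ≤ h) where

  open DoublingResidue ((h + 1) * t + 1)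

  label : ℤ → ℕ
  label x = h * residue x

  span-bound : ℕ
  span-bound = h * (2 * ((h + 1) * t + 1))

  double-span-bound : 2 * span-bound ≡ t * suc (2 * h) * suc (2 * h) + 2 * suc (2 * h) ∸ (t + 2)
  double-span-bound = sym (trans (cong (_∸ (t + 2)) (eq t h)) (m+n∸m≡n (t + 2) (2 * span-bound)))
    where
    eq : ∀ t h → t * suc (2 * h) * suc (2 * h) + 2 * suc (2 * h) ≡ (t + 2) + 2 * (h * (2 * ((h + 1) * t + 1)))
    eq = solve-∀

  label-≤ : ∀ x → label x ≤ span-bound
  label-≤ x = *-monoʳ-≤ h (residue-≤ x)

  <N : ∀ {a} → a ≤ 2 * ((h + 1) * t) + 2 → a < N
  <N a≤ = s≤s (≤-trans a≤ (≤-reflexive (sym (*-distribˡ-+ 2 ((h + 1) * t) 1))))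

  label-isRadio : IsRadioLabeling (G t) (suc (2 * h)) label
  label-isRadio u v u≢v n (u⇝v , _) =
    subst (λ d → suc (2 * h) + 1 ≤ d + n) (*-distribˡ-∣-∣ h (residue u) (residue v))
      (2h+2≤h*g+n 1≤h (walk-length-pos u≢v u⇝v) gap≥1 gap≥2 gap≥3)
    where
    D : ℕ
    D = ℤ.∣ u ℤ.- v ∣
    gap : ℕ
    gap = ∣ residue u - residue v ∣
    1≤D : 1 ≤ D
    1≤D = n≢0⇒n>0 (λ D≡0 → u≢v (ℤ.i-j≡0⇒i≡j u v (ℤ.∣i∣≡0⇒i≡0 D≡0)))
    D≤ : ∀ {c} → n ≤ c → D ≤ c * t
    D≤ n≤c = ≤-trans (walk-displacement-≤ (m∸n≤m t 1 ∷ ≤-refl ∷ []) u⇝v) (*-monoˡ-≤ t n≤c)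
    gap>e : ∀ {e} → e < 2 * D → e ≤ 2 → n ≤ h + 1 → e < gap
    gap>e e<2D e≤2 n≤h+1 = residue-gap-> u v e<2D (<N (+-mono-≤ (*-monoʳ-≤ 2 (D≤ n≤h+1)) e≤2))
    gap≥1 : n ≤ 2 * h + 1 → 1 ≤ gap
    gap≥1 n≤2h+1 = n≢0⇒n>0 (residue-injective u v 1≤D (<N (begin
      D                    ≤⟨ D≤ n≤2h+1 ⟩
      (2 * h + 1) * t      ≤⟨ *-monoˡ-≤ t (+-monoʳ-≤ (2 * h) (s≤s z≤n)) ⟩
      (2 * h + 2) * t      ≡⟨ eq h t ⟩
      2 * ((h + 1) * t)    ≤⟨ m≤m+n _ 2 ⟩
      2 * ((h + 1) * t) + 2 ∎)) ∘ ∣m-n∣≡0⇒m≡n)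
      where
      open ≤-Reasoning
      eq : ∀ h t → (2 * h + 2) * t ≡ 2 * ((h + 1) * t)
      eq = solve-∀
    gap≥2 : n ≤ h + 1 → 2 ≤ gap
    gap≥2 = gap>e (*-monoʳ-≤ 2 1≤D) (s≤s z≤n)
    gap≥3 : n ≤ 1 → 3 ≤ gap
    gap≥3 n≤1 = gap>e (<⇒≤ (*-monoʳ-≤ 2 2≤D)) ≤-refl (≤-trans n≤1 (m≤n+m 1 h))
      where
      2≤D : 2 ≤ D
      2≤D = All.lookup (∸-monoˡ-≤ 1 2<t ∷ <⇒≤ 2<t ∷ []) (walk-≤1⇒adjacent u≢v n≤1 u⇝v)

theorem6 : (t k : ℕ) → 2 < t → 3 ≤ k → ¬ (2 ∣ k) →
    (B : ℕ) → 2 * B ≡ t * k * k + 2 * k ∸ (t + 2) →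
    RlAtMost (G t) k B
theorem6 t k 2<t 3≤k 2∤k B 2B≡ with odd⇒≡suc-double k 2∤k
... | zero , refl = contradiction 3≤k λ { (s≤s ()) }
... | suc h , refl = label , label-isRadio , bounded⇒SpanAtMost label≤B
  where
  open Construction t (suc h) 2<t (s≤s z≤n)
  label≤B : ∀ x → label x ≤ B
  label≤B x = subst (label x ≤_) (*-cancelˡ-≡ span-bound B 2 (trans double-span-bound (sym 2B≡))) (label-≤ x)
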